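{- Let $b$ be an open branch of a terminated $LET_F$-tableau. Then there exists an $LET_F$-valuation $v$ such that for every formula $F$: if $1(F)$ occurs in $b$ then $v(F)=1$, and if $0(F)$ occurs in $b$ then $v(F)=0$.
   Context: The language $\mathcal{L}$ of $LET_F$ has propositional letters, unary connectives $\circ,\bullet,\neg$, binary $\wedge,\vee$. An $LET_F$-valuation is a function $v:\mathcal{L}\to\{0,1\}$ such that for all formulas $A,B$: (v1) $v(A\wedge B)=1$ iff $v(A)=1$ and $v(B)=1$; (v2) $v(A\vee B)=1$ iff $v(A)=1$ or $v(B)=1$; (v3) $v(\neg(A\wedge B))=1$ iff $v(\neg A)=1$ or $v(\neg B)=1$; (v4) $v(\neg(A\vee B))=1$ iff $v(\neg A)=1$ and $v(\neg B)=1$; (v5) $v(A)=1$ iff $v(\neg\neg A)=1$; (v6) if $v(\circ A)=1$ then ($v(A)=1$ iff $v(\neg A)=0$); (v7) $v(\bullet A)=1$ iff $v(\circ A)=0$. Tableau rules on signed formulas $1(F)$, $0(F)$ ("$\mid$" = branching): R1: $1(A\wedge B) \Rightarrow 1(A), 1(B)$. R2: $0(A\wedge B) \Rightarrow 0(A) \mid 0(B)$. R3: $1(\neg(A\wedge B)) \Rightarrow 1(\neg A) \mid 1(\neg B)$. R4: $0(\neg(A\wedge B)) \Rightarrow 0(\neg A), 0(\neg B)$. R5: $1(A\vee B) \Rightarrow 1(A) \mid 1(B)$. R6: $0(A\vee B) \Rightarrow 0(A), 0(B)$. R7: $1(\neg(A\vee B)) \Rightarrow 1(\neg A), 1(\neg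 B)$. R8: $0(\neg(A\vee B)) \Rightarrow 0(\neg A) \mid 0(\neg B)$. R9: $1(\neg\neg A) \Rightarrow 1(A)$. R10: $0(\neg\neg A) \Rightarrow 0(A)$. R11: $1(\circ A) \Rightarrow 1(A), 0(\neg A) \mid 0(A), 1(\neg A)$. R12: $1(\bullet A) \Rightarrow 0(\circ A)$. R13: $0(\bullet A) \Rightarrow 1(\circ A)$. No other rules. A tableau for a set $\Delta$ of signed formulas is a tree whose first node contains $\Delta$ and whose further nodes arise by applying rules (a branch is a maximal path, viewed as the set of signed formulas on it). A branch is closed if it contains $1(F)$ and $0(F)$ for some $F$, open otherwise. A tableau is terminated when no rule can be applied on any open branch, i.e. for every signed formula on an open branch to which a rule applies, the branch contains the conclusions of that rule (of one of its alternatives, for branching rules). -}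

module Defs where

open import Data.Nat using (ℕ)
open import Data.Bool using (Bool; true; false)
open import Data.List using (List; []; _∷_; _++_)
open import Data.List.Membership.Propositional using (_∈_)
open import Data.List.Relation.Unary.All using (All)
open import Data.Sum using (_⊎_)
open import Data.Product using (Σ; _×_; ∃; _,_)
open import Relation.Binary.PropositionalEquality using (_≡_)
open import Relation.Nullary using (¬_)
open import Function.Bundles using (_⇔_)

infixr 6 _⋀_
infixr 5 _⋁_
data Formula : Set where
  var  : ℕ → Formula
  ○_   : Formula → Formula
  ●_   : Formula → Formula
  ~_   : Formula → Formula
  _⋀_  : Formula → Formula → Formula
  _⋁_  : Formula → Formula → Formula

record IsValuation (v : Formula → Bool) : Set where
  field
    v1 : ∀ A B → (v (A ⋀ B) ≡ true) ⇔ (v A ≡ true × v B ≡ true)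
    v2 : ∀ A B → (v (A ⋁ B) ≡ true) ⇔ (v A ≡ true ⊎ v B ≡ true)
    v3 : ∀ A B → (v (~ (A ⋀ B)) ≡ true) ⇔ (v (~ A) ≡ true ⊎ v (~ B) ≡ true)
    v4 : ∀ A B → (v (~ (A ⋁ B)) ≡ true) ⇔ (v (~ A) ≡ true × v (~ B) ≡ true)
    v5 : ∀ A → (v A ≡ true) ⇔ (v (~ (~ A)) ≡ true)
    v6 : ∀ A → v (○ A) ≡ true → ((v A ≡ true) ⇔ (v (~ A) ≡ false))
    v7 : ∀ A → (v (● A) ≡ true) ⇔ (v (○ A) ≡ false)

data Signed : Set where
  one  : Formula → Signed
  zero : Formula → Signed

-- Applies φ alts : a tableau rule has premise φ and list of alternatives
-- (each alternative is the list of its conclusions; one alternative = non-branching).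
data Applies : Signed → List (List Signed) → Set where
  R1  : ∀ {A B} → Applies (one (A ⋀ B)) ((one A ∷ one B ∷ []) ∷ [])
  R2  : ∀ {A B} → Applies (zero (A ⋀ B)) ((zero A ∷ []) ∷ (zero B ∷ []) ∷ [])
  R3  : ∀ {A B} → Applies (one (~ (A ⋀ B))) ((one (~ A) ∷ []) ∷ (one (~ B) ∷ []) ∷ [])
  R4  : ∀ {A B} → Applies (zero (~ (A ⋀ B))) ((zero (~ A) ∷ zero (~ B) ∷ []) ∷ [])
  R5  : ∀ {A B} → Applies (one (A ⋁ B)) ((one A ∷ []) ∷ (one B ∷ []) ∷ [])
  R6  : ∀ {A B} → Applies (zero (A ⋁ B)) ((zero A ∷ zero B ∷ []) ∷ [])
  R7  : ∀ {A B} → Applies (one (~ (A ⋁ B))) ((one (~ A) ∷ one (~ B) ∷ []) ∷ [])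
  R8  : ∀ {A B} → Applies (zero (~ (A ⋁ B))) ((zero (~ A) ∷ []) ∷ (zero (~ B) ∷ []) ∷ [])
  R9  : ∀ {A} → Applies (one (~ (~ A))) ((one A ∷ []) ∷ [])
  R10 : ∀ {A} → Applies (zero (~ (~ A))) ((zero A ∷ []) ∷ [])
  R11 : ∀ {A} → Applies (one (○ A)) ((one A ∷ zero (~ A) ∷ []) ∷ (zero A ∷ one (~ A) ∷ []) ∷ [])
  R12 : ∀ {A} → Applies (one (● A)) ((zero (○ A) ∷ []) ∷ [])
  R13 : ∀ {A} → Applies (zero (● A)) ((one (○ A) ∷ []) ∷ [])

-- Tableau Γ : a (finite) tableau whose current path so far carries the
-- signed formulas Γ.
data Tableau : List Signed → Set where
  leaf : ∀ {Γ} → Tableau Γ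
  node : ∀ {Γ φ alts} → φ ∈ Γ → Applies φ alts →
         ((c : List Signed) → c ∈ alts → Tableau (c ++ Γ)) → Tableau Γ

data Branch : ∀ {Γ} → Tableau Γ → List Signed → Set where
  here  : ∀ {Γ} → Branch (leaf {Γ}) Γ
  there : ∀ {Γ φ alts} {p : φ ∈ Γ} {r : Applies φ alts}
            {ch : (c : List Signed) → c ∈ alts → Tableau (c ++ Γ)}
            {c : List Signed} (c∈ : c ∈ alts) {b : List Signed} →
            Branch (ch c c∈) b → Branch (node p r ch) b

Closed : List Signed → Set
Closed b = Σ Formula λ F → one F ∈ b × zero F ∈ b

Open : List Signed → Set
Open b = ¬ Closed b

-- no rule can be applied on b: for every applicable rule, b contains the
-- conclusions of one of its alternatives
Saturated : List Signed → Set
Saturated b = ∀ φ alts → φ ∈ b → Applies φ alts →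
              Σ (List Signed) λ c → c ∈ alts × All (_∈ b) c

Terminated : ∀ {Γ} → Tableau Γ → Set
Terminated t = ∀ b → Branch t b → Open b → Saturated b

-- A branch that is open and saturated under the rules is a Hintikka set, and
-- every Hintikka set is satisfied by the valuation it suggests. Read the value
-- of F and of ¬F off the branch when F is a letter (and ¬F also when F is ○A
-- or ●A), and propagate by (v1)-(v5) otherwise; let ○A hold exactly when
-- 0(○A) is not on the branch and A, ¬A get opposite values, and ●A when ○A
-- fails. Clauses (v1)-(v7) then hold by construction, and agreement with the
-- branch follows by induction on F, each case using the tableau rule for the
-- formula at hand.
module Submission where

open import Defs
open import Data.Bool using (Bool; true; false; _∧_; _∨_; not; _xor_)
open import Data.Bool.Properties using (∧-zeroʳ; ∨-zeroʳ)
import Data.Nat as ℕ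
open import Data.List using (List; []; _∷_)
open import Data.List.Membership.Propositional using (_∈_)
open import Data.List.Relation.Unary.Any using (here; there)
open import Data.List.Relation.Unary.All using (All; []; _∷_)
open import Data.Product using (Σ; _×_; _,_; uncurry)
open import Data.Sum using (_⊎_; inj₁; inj₂)
open import Relation.Binary.PropositionalEquality using (_≡_; refl; cong; cong₂)
open import Relation.Binary.Definitions using (DecidableEquality)
open import Relation.Nullary using (no; does)
open import Relation.Nullary.Decidable using (map′; _×-dec_; dec-true; dec-false)
open import Function.Bundles using (_⇔_; mk⇔)
open import Function.Construct.Identity using (⇔-id)

infix 4 _≟ᶠ_ _≟ˢ_

_≟ᶠ_ : DecidableEquality Formula
var m ≟ᶠ var n = map′ (cong var) (λ { refl → refl }) (m ℕ.≟ n)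
○ A ≟ᶠ ○ B = map′ (cong ○_) (λ { refl → refl }) (A ≟ᶠ B)
● A ≟ᶠ ● B = map′ (cong ●_) (λ { refl → refl }) (A ≟ᶠ B)
~ A ≟ᶠ ~ B = map′ (cong ~_) (λ { refl → refl }) (A ≟ᶠ B)
A ⋀ B ≟ᶠ C ⋀ D = map′ (uncurry (cong₂ _⋀_)) (λ { refl → refl , refl }) (A ≟ᶠ C ×-dec B ≟ᶠ D)
A ⋁ B ≟ᶠ C ⋁ D = map′ (uncurry (cong₂ _⋁_)) (λ { refl → refl , refl }) (A ≟ᶠ C ×-dec B ≟ᶠ D)
var _ ≟ᶠ ○ _ = no λ ()
var _ ≟ᶠ ● _ = no λ ()
var _ ≟ᶠ ~ _ = no λ ()
var _ ≟ᶠ _ ⋀ _ = no λ ()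
var _ ≟ᶠ _ ⋁ _ = no λ ()
○ _ ≟ᶠ var _ = no λ ()
○ _ ≟ᶠ ● _ = no λ ()
○ _ ≟ᶠ ~ _ = no λ ()
○ _ ≟ᶠ _ ⋀ _ = no λ ()
○ _ ≟ᶠ _ ⋁ _ = no λ ()
● _ ≟ᶠ var _ = no λ ()
● _ ≟ᶠ ○ _ = no λ ()
● _ ≟ᶠ ~ _ = no λ ()
● _ ≟ᶠ _ ⋀ _ = no λ ()
● _ ≟ᶠ _ ⋁ _ = no λ ()
~ _ ≟ᶠ var _ = no λ ()
~ _ ≟ᶠ ○ _ = no λ ()
~ _ ≟ᶠ ● _ = no λ ()
~ _ ≟ᶠ _ ⋀ _ = no λ ()
~ _ ≟ᶠ _ ⋁ _ = no λ ()
_ ⋀ _ ≟ᶠ var _ = no λ ()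
_ ⋀ _ ≟ᶠ ○ _ = no λ ()
_ ⋀ _ ≟ᶠ ● _ = no λ ()
_ ⋀ _ ≟ᶠ ~ _ = no λ ()
_ ⋀ _ ≟ᶠ _ ⋁ _ = no λ ()
_ ⋁ _ ≟ᶠ var _ = no λ ()
_ ⋁ _ ≟ᶠ ○ _ = no λ ()
_ ⋁ _ ≟ᶠ ● _ = no λ ()
_ ⋁ _ ≟ᶠ ~ _ = no λ ()
_ ⋁ _ ≟ᶠ _ ⋀ _ = no λ ()

_≟ˢ_ : DecidableEquality Signed
one A ≟ˢ one B = map′ (cong one) (λ { refl → refl }) (A ≟ᶠ B)
zero A ≟ˢ zero B = map′ (cong zero) (λ { refl → refl }) (A ≟ᶠ B)
one _ ≟ˢ zero _ = no λ ()
zero _ ≟ˢ one _ = no λ ()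

open import Data.List.Membership.DecPropositional _≟ˢ_ using (_∈?_)

∧-true⇔ : ∀ {x y} → (x ∧ y ≡ true) ⇔ (x ≡ true × y ≡ true)
∧-true⇔ {true} {true} = mk⇔ (λ _ → refl , refl) (λ _ → refl)
∧-true⇔ {true} {false} = mk⇔ (λ ()) (λ ())
∧-true⇔ {false} = mk⇔ (λ ()) (λ ())

∧-intro : ∀ {x y} → x ≡ true → y ≡ true → x ∧ y ≡ true
∧-intro refl refl = refl

∧-trueʳ : ∀ x {y} → x ∧ y ≡ true → y ≡ true
∧-trueʳ true y≡true = y≡true

∧-falseˡ : ∀ {x} y → x ≡ false → x ∧ y ≡ false
∧-falseˡ y refl = refl

∧-falseʳ : ∀ x {y} → y ≡ false → x ∧ y ≡ false
∧-falseʳ x refl = ∧-zeroʳ x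

∨-true⇔ : ∀ {x y} → (x ∨ y ≡ true) ⇔ (x ≡ true ⊎ y ≡ true)
∨-true⇔ {true} = mk⇔ (λ _ → inj₁ refl) (λ _ → refl)
∨-true⇔ {false} {true} = mk⇔ (λ _ → inj₂ refl) (λ _ → refl)
∨-true⇔ {false} {false} = mk⇔ (λ ()) λ { (inj₁ ()) ; (inj₂ ()) }

∨-introˡ : ∀ {x} y → x ≡ true → x ∨ y ≡ true
∨-introˡ y refl = refl

∨-introʳ : ∀ x {y} → y ≡ true → x ∨ y ≡ true
∨-introʳ x refl = ∨-zeroʳ x

∨-false : ∀ {x y} → x ≡ false → y ≡ false → x ∨ y ≡ false
∨-false refl refl = refl

not-true⇔ : ∀ {x} → (not x ≡ true) ⇔ (x ≡ false)
not-true⇔ {true} = mk⇔ (λ ()) (λ ())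
not-true⇔ {false} = mk⇔ (λ _ → refl) (λ _ → refl)

xor-true⇒⇔ : ∀ {x y} → x xor y ≡ true → (x ≡ true) ⇔ (y ≡ false)
xor-true⇒⇔ {true} {false} _ = mk⇔ (λ _ → refl) (λ _ → refl)
xor-true⇒⇔ {false} {true} _ = mk⇔ (λ ()) (λ ())

xor-trueˡ : ∀ {x y} → x ≡ true → y ≡ false → x xor y ≡ true
xor-trueˡ refl refl = refl

xor-trueʳ : ∀ {x y} → x ≡ false → y ≡ true → x xor y ≡ true
xor-trueʳ refl refl = refl

module _ {b : List Signed} (sat : Saturated b) where

  saturated-linear : ∀ {φ c} → φ ∈ b → Applies φ (c ∷ []) → All (_∈ b) c
  saturated-linear φ∈b rule with sat _ _ φ∈b rule
  ... | _ , here refl , c⊆b = c⊆b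
  ... | _ , there () , _

  saturated-branching : ∀ {φ c d} → φ ∈ b → Applies φ (c ∷ d ∷ []) →
                        All (_∈ b) c ⊎ All (_∈ b) d
  saturated-branching φ∈b rule with sat _ _ φ∈b rule
  ... | _ , here refl , c⊆b = inj₁ c⊆b
  ... | _ , there (here refl) , d⊆b = inj₂ d⊆b
  ... | _ , there (there ()) , _

_⊨_ : (Formula → Bool) → List Signed → Set
v ⊨ b = ∀ F → (one F ∈ b → v F ≡ true) × (zero F ∈ b → v F ≡ false)

module Hintikka (b : List Signed) (b-open : Open b) (sat : Saturated b) where

  asserted refuted : Formula → Bool
  asserted F = does (one F ∈? b)
  refuted F = does (zero F ∈? b)

  asserted-one : ∀ {F} → one F ∈ b → asserted F ≡ true
  asserted-one {F} = dec-true (one F ∈? b)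

  asserted-zero : ∀ {F} → zero F ∈ b → asserted F ≡ false
  asserted-zero {F} 0F = dec-false (one F ∈? b) λ 1F → b-open (F , 1F , 0F)

  refuted-one : ∀ {F} → one F ∈ b → refuted F ≡ false
  refuted-one {F} 1F = dec-false (zero F ∈? b) λ 0F → b-open (F , 1F , 0F)

  refuted-zero : ∀ {F} → zero F ∈ b → refuted F ≡ true
  refuted-zero {F} = dec-true (zero F ∈? b)

  -- negValue F is the value of ¬F: negation is not truth-functional, so it is
  -- computed alongside value rather than from it.
  value negValue classical : Formula → Bool
  value (var n) = asserted (var n)
  value (○ A) = classical A
  value (● A) = not (classical A)
  value (~ A) = negValue A
  value (A ⋀ B) = value A ∧ value B
  value (A ⋁ B) = value A ∨ value B
  negValue (var n) = asserted (~ var n)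
  negValue (○ A) = asserted (~ ○ A)
  negValue (● A) = asserted (~ ● A)
  negValue (~ A) = value A
  negValue (A ⋀ B) = negValue A ∨ negValue B
  negValue (A ⋁ B) = negValue A ∧ negValue B
  classical A = not (refuted (○ A)) ∧ (value A xor negValue A)

  classical-zero : ∀ A → zero (○ A) ∈ b → classical A ≡ false
  classical-zero A 0○A = ∧-falseˡ _ (cong not (refuted-zero 0○A))

  isValuation : IsValuation value
  isValuation = record
    { v1 = λ A B → ∧-true⇔
    ; v2 = λ A B → ∨-true⇔
    ; v3 = λ A B → ∨-true⇔
    ; v4 = λ A B → ∧-true⇔
    ; v5 = λ A → ⇔-id _
    ; v6 = λ A ○A → xor-true⇒⇔ (∧-trueʳ (not (refuted (○ A))) ○A)
    ; v7 = λ A → not-true⇔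
    }

  value-one : ∀ F → one F ∈ b → value F ≡ true
  value-zero : ∀ F → zero F ∈ b → value F ≡ false
  negValue-one : ∀ F → one (~ F) ∈ b → negValue F ≡ true
  negValue-zero : ∀ F → zero (~ F) ∈ b → negValue F ≡ false
  classical-one : ∀ A → one (○ A) ∈ b → classical A ≡ true

  classical-one A 1○A with saturated-branching sat 1○A R11
  ... | inj₁ (1A ∷ 0¬A ∷ []) =
    ∧-intro (cong not (refuted-one 1○A)) (xor-trueˡ (value-one A 1A) (negValue-zero A 0¬A))
  ... | inj₂ (0A ∷ 1¬A ∷ []) =
    ∧-intro (cong not (refuted-one 1○A)) (xor-trueʳ (value-zero A 0A) (negValue-one A 1¬A))

  value-one (var n) 1F = asserted-one 1F
  value-one (○ A) 1F = classical-one A 1F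
  value-one (● A) 1F with saturated-linear sat 1F R12
  ... | 0○A ∷ [] = cong not (classical-zero A 0○A)
  value-one (~ A) 1F = negValue-one A 1F
  value-one (A ⋀ B) 1F with saturated-linear sat 1F R1
  ... | 1A ∷ 1B ∷ [] = ∧-intro (value-one A 1A) (value-one B 1B)
  value-one (A ⋁ B) 1F with saturated-branching sat 1F R5
  ... | inj₁ (1A ∷ []) = ∨-introˡ (value B) (value-one A 1A)
  ... | inj₂ (1B ∷ []) = ∨-introʳ (value A) (value-one B 1B)

  value-zero (var n) 0F = asserted-zero 0F
  value-zero (○ A) 0F = classical-zero A 0F
  value-zero (● A) 0F with saturated-linear sat 0F R13
  ... | 1○A ∷ [] = cong not (classical-one A 1○A)
  value-zero (~ A) 0F = negValue-zero A 0F
  value-zero (A ⋀ B) 0F with saturated-branching sat 0F R2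
  ... | inj₁ (0A ∷ []) = ∧-falseˡ (value B) (value-zero A 0A)
  ... | inj₂ (0B ∷ []) = ∧-falseʳ (value A) (value-zero B 0B)
  value-zero (A ⋁ B) 0F with saturated-linear sat 0F R6
  ... | 0A ∷ 0B ∷ [] = ∨-false (value-zero A 0A) (value-zero B 0B)

  negValue-one (var n) 1¬F = asserted-one 1¬F
  negValue-one (○ A) 1¬F = asserted-one 1¬F
  negValue-one (● A) 1¬F = asserted-one 1¬F
  negValue-one (~ A) 1¬F with saturated-linear sat 1¬F R9
  ... | 1A ∷ [] = value-one A 1A
  negValue-one (A ⋀ B) 1¬F with saturated-branching sat 1¬F R3
  ... | inj₁ (1¬A ∷ []) = ∨-introˡ (negValue B) (negValue-one A 1¬A)
  ... | inj₂ (1¬B ∷ []) = ∨-introʳ (negValue A) (negValue-one B 1¬B)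
  negValue-one (A ⋁ B) 1¬F with saturated-linear sat 1¬F R7
  ... | 1¬A ∷ 1¬B ∷ [] = ∧-intro (negValue-one A 1¬A) (negValue-one B 1¬B)

  negValue-zero (var n) 0¬F = asserted-zero 0¬F
  negValue-zero (○ A) 0¬F = asserted-zero 0¬F
  negValue-zero (● A) 0¬F = asserted-zero 0¬F
  negValue-zero (~ A) 0¬F with saturated-linear sat 0¬F R10
  ... | 0A ∷ [] = value-zero A 0A
  negValue-zero (A ⋀ B) 0¬F with saturated-linear sat 0¬F R4
  ... | 0¬A ∷ 0¬B ∷ [] = ∨-false (negValue-zero A 0¬A) (negValue-zero B 0¬B)
  negValue-zero (A ⋁ B) 0¬F with saturated-branching sat 0¬F R8
  ... | inj₁ (0¬A ∷ []) = ∧-falseˡ (negValue B) (negValue-zero A 0¬A)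
  ... | inj₂ (0¬B ∷ []) = ∧-falseʳ (negValue A) (negValue-zero B 0¬B)

  value⊨b : value ⊨ b
  value⊨b F = value-one F , value-zero F

hintikka-satisfiable : ∀ b → Open b → Saturated b → Σ (Formula → Bool) λ v → IsValuation v × v ⊨ b
hintikka-satisfiable b b-open sat = value , isValuation , value⊨b
  where open Hintikka b b-open sat

lemma13 : ∀ {Δ : List Signed} (t : Tableau Δ) → Terminated t →
            ∀ (b : List Signed) → Branch t b → Open b →
              Σ (Formula → Bool) λ v → IsValuation v ×
                (∀ F → (one F ∈ b → v F ≡ true) × (zero F ∈ b → v F ≡ false))
lemma13 t terminated b branch b-open = hintikka-satisfiable b b-open (terminated b branch b-open)
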